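{- Let $n\ge 3$, let $\mathrm{D}_{2n}=\langle a,b\mid a^n=b^2=(ab)^2=e\rangle$ be the dihedral group of order $2n$, and let $H=\langle a^t\rangle$ where $t$ is a positive divisor of $n$. (a) $H$ is a perfect code of $\mathrm{D}_{2n}$ if and only if either $t$ or $n/t$ is odd. (b) $H$ is a total perfect code of $\mathrm{D}_{2n}$ if and only if $t$ is odd and $n/t$ is even.
   Context: All groups and graphs are finite; $e$ denotes the identity. For a group $G$ and $S\subseteq G$ with $e\notin S$ and $S^{ -1}=S$, the Cayley graph $\mathrm{Cay}(G,S)$ has vertex set $G$, with $x,y$ adjacent iff $yx^{ -1}\in S$. A subset $C$ of the vertex set of a graph is a perfect code if every vertex is at distance at most one from exactly one vertex of $C$; it is a total perfect code if every vertex has exactly one neighbour in $C$. A subset $C\subseteq G$ is called a perfect code (resp. total perfect code) of $G$ if it is a perfect code (resp. total perfect code) in some Cayley graph $\mathrm{Cay}(G,S)$ of $G$. -}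

module Defs where

open import Data.Nat using (ℕ; zero; suc; _+_; _∸_; NonZero)
open import Data.Nat.DivMod using (_mod_)
open import Data.Fin using (Fin; toℕ)
open import Data.Bool using (Bool; true; false; _xor_)
open import Data.Product using (Σ; _×_; _,_; ∃; ∃-syntax)
open import Data.Sum using (_⊎_)
open import Relation.Nullary using (¬_)
open import Relation.Binary.PropositionalEquality using (_≡_)

-- The dihedral group D_{2n} = ⟨a,b | a^n = b^2 = (ab)^2 = e⟩, realised concretely:
-- the pair (i , j) stands for a^i b^j  (i ∈ Z/n, j = true meaning b^1).
D : ℕ → Set
D n = Fin n × Bool

module Dihedral (n : ℕ) .{{_ : NonZero n}} where

  e : D n
  e = (0 mod n , false)

  -- (a^i b^j)(a^k b^l) = a^(i ± k) b^(j+l), sign − iff j = b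
  _·_ : D n → D n → D n
  (i , false) · (k , l) = ((toℕ i + toℕ k) mod n , l)
  (i , true)  · (k , l) = ((toℕ i + (n ∸ toℕ k)) mod n , true xor l)

  _⁻¹ : D n → D n
  (i , false) ⁻¹ = ((n ∸ toℕ i) mod n , false)
  (i , true)  ⁻¹ = (i , true)

  a : D n
  a = (1 mod n , false)

  b : D n
  b = (0 mod n , true)

  pow : D n → ℕ → D n
  pow g zero    = e
  pow g (suc k) = pow g k · g

  ⟨_⟩ : D n → D n → Set
  ⟨ g ⟩ x = ∃[ k ] x ≡ pow g k

  IsConnectionSet : (D n → Set) → Set
  IsConnectionSet S = ¬ S e × (∀ x → S x → S (x ⁻¹))

  Adj : (D n → Set) → D n → D n → Set
  Adj S x y = S (y · (x ⁻¹))

  ExactlyOne : (D n → Set) → Set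
  ExactlyOne P = Σ (D n) λ c → P c × (∀ c' → P c' → c' ≡ c)

  IsPerfectCodeIn : (D n → Set) → (D n → Set) → Set
  IsPerfectCodeIn S C = ∀ x → ExactlyOne (λ c → C c × (x ≡ c ⊎ Adj S c x))

  IsTotalPerfectCodeIn : (D n → Set) → (D n → Set) → Set
  IsTotalPerfectCodeIn S C = ∀ x → ExactlyOne (λ c → C c × Adj S x c)

  IsPerfectCode : (D n → Set) → Set₁
  IsPerfectCode C = Σ (D n → Set) λ S → IsConnectionSet S × IsPerfectCodeIn S C

  IsTotalPerfectCode : (D n → Set) → Set₁
  IsTotalPerfectCode C = Σ (D n → Set) λ S → IsConnectionSet S × IsTotalPerfectCodeIn S C

-- Rotations a^i form ℤ/n and H = ⟨a^t⟩ is the subgroup tℤ/n. With adjacency y x⁻¹ ∈ S, H is a perfect code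
-- (resp. total perfect code) of Cay(D_{2n}, S) iff S ∪ {e} (resp. S) meets every coset of H exactly once. The
-- reflection cosets are always met by the reflections a^i b with i < t, so everything rests on finding an
-- inverse-closed set R of rotations meeting each coset i + tℤ once and containing (resp. avoiding) 0. The cosets
-- ±r pair off, except r = 0 and, for even t, r = t/2: the latter has an inverse-closed member, necessarily the half
-- turn n/2, iff n/t is odd, and the coset tℤ has a nonzero one iff n/t is even. Conversely, if x² ∈ H then the
-- reflection c ↦ x² c⁻¹ of H preserves the set of code elements attached to the rotation x, so by uniqueness it
-- has a fixed point; for x = a^{t/2} (resp. x = e) that fixed point violates the parity conditions.

module Submission where

open import Defs
open import Data.Nat using (ℕ; _≤_; _/_; NonZero)
open import Data.Nat.Divisibility using (_∣_)
open import Data.Product using (_×_)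
open import Data.Sum using (_⊎_)
open import Relation.Nullary using (¬_)
open import Function.Bundles using (_⇔_)

open import Level using (0ℓ)
open import Data.Nat using (_+_; _*_; _∸_; _<_; _%_; _≟_; zero; suc; z≤n; s≤s; z<s; >-nonZero⁻¹; ≢-nonZero⁻¹)
open import Data.Nat.Tactic.RingSolver using (solve-∀)
open import Data.Nat.Properties
open import Data.Nat.DivMod
open import Data.Nat.Divisibility
open import Data.Fin using (Fin; toℕ; fromℕ<)
open import Data.Bool using (true; false)
open import Data.Fin.Properties using (toℕ-fromℕ<; toℕ-injective; toℕ<n) renaming (_≟_ to _≟ᶠ_)
open import Data.Product using (∃; ∃!; _,_; proj₁; proj₂; map₂)
open import Data.Sum using (inj₁; inj₂)
open import Function using (_∘_)
open import Function.Bundles using (mk⇔; Equivalence)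
open import Relation.Nullary using (yes; no; contradiction)
open import Relation.Binary.Definitions using (tri<; tri≈; tri>)
open import Relation.Binary.PropositionalEquality
open import Algebra.Bundles using (AbelianGroup)
open import Algebra.Structures using (IsAbelianGroup)

infix 4 _≋⟨_⟩_

_≋⟨_⟩_ : ℕ → (d : ℕ) .{{_ : NonZero d}} → ℕ → Set
x ≋⟨ d ⟩ y = x % d ≡ y % d

module _ {d : ℕ} .{{_ : NonZero d}} where

  m%d≋m : ∀ x → x % d ≋⟨ d ⟩ x
  m%d≋m x = m%n%n≡m%n x d

  +-cong-≋ : ∀ {a b c e} → a ≋⟨ d ⟩ b → c ≋⟨ d ⟩ e → a + c ≋⟨ d ⟩ b + e
  +-cong-≋ {a} {b} {c} {e} a≋b c≋e = begin
    (a + c) % d            ≡⟨ %-distribˡ-+ a c d ⟩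
    (a % d + c % d) % d    ≡⟨ cong₂ (λ x y → (x + y) % d) a≋b c≋e ⟩
    (b % d + e % d) % d    ≡⟨ %-distribˡ-+ b e d ⟨
    (b + e) % d            ∎
    where open ≡-Reasoning

  *-congˡ-≋ : ∀ k {a b} → a ≋⟨ d ⟩ b → k * a ≋⟨ d ⟩ k * b
  *-congˡ-≋ k {a} {b} a≋b = begin
    (k * a) % d              ≡⟨ %-distribˡ-* k a d ⟩
    (k % d * (a % d)) % d    ≡⟨ cong (λ x → (k % d * x) % d) a≋b ⟩
    (k % d * (b % d)) % d    ≡⟨ %-distribˡ-* k b d ⟨
    (k * b) % d              ∎
    where open ≡-Reasoning

  0%d≡0 : 0 % d ≡ 0
  0%d≡0 = m<n⇒m%n≡m (>-nonZero⁻¹ d)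

  d∸x+x≋0 : ∀ {x} → x ≤ d → (d ∸ x) + x ≋⟨ d ⟩ 0
  d∸x+x≋0 x≤d = trans (cong (_% d) (m∸n+n≡m x≤d)) (trans (n%n≡0 d) (sym 0%d≡0))

  -- adding d ∸ c % d undoes adding c
  +-cancelʳ-≋ : ∀ {a b} c → a + c ≋⟨ d ⟩ b + c → a ≋⟨ d ⟩ b
  +-cancelʳ-≋ {a} {b} c a+c≋b+c = trans (sym (undo a)) (trans (+-cong-≋ a+c≋b+c refl) (undo b))
    where
    c⁻ = d ∸ c % d
    c+c⁻≋0 : c + c⁻ ≋⟨ d ⟩ 0
    c+c⁻≋0 = trans (cong (_% d) (+-comm c c⁻)) (trans (+-cong-≋ {a = c⁻} refl (sym (m%d≋m c))) (d∸x+x≋0 (m%n≤n c d)))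
    undo : ∀ x → x + c + c⁻ ≋⟨ d ⟩ x
    undo x = trans (cong (_% d) (+-assoc x c c⁻)) (trans (+-cong-≋ {a = x} refl c+c⁻≋0) (cong (_% d) (+-identityʳ x)))

  <-≋⇒≡ : ∀ {a b} → a < d → b < d → a ≋⟨ d ⟩ b → a ≡ b
  <-≋⇒≡ a<d b<d a≋b = trans (sym (m<n⇒m%n≡m a<d)) (trans a≋b (m<n⇒m%n≡m b<d))

  ∣⇒≋0 : ∀ {a} → d ∣ a → a ≋⟨ d ⟩ 0
  ∣⇒≋0 {a} d∣a = trans (n∣m⇒m%n≡0 a d d∣a) (sym 0%d≡0)

  ≋0⇒∣ : ∀ {a} → a ≋⟨ d ⟩ 0 → d ∣ a
  ≋0⇒∣ {a} a≋0 = m%n≡0⇒n∣m a d (trans a≋0 0%d≡0)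

  ≋-∣-weaken : ∀ {d′} .{{_ : NonZero d′}} {a b} → d′ ∣ d → a ≋⟨ d ⟩ b → a ≋⟨ d′ ⟩ b
  ≋-∣-weaken {d′} {a = a} {b} d′∣d a≋b =
    trans (sym (m∣n⇒o%n%m≡o%m d′ d a d′∣d)) (trans (cong (_% d′) a≋b) (m∣n⇒o%n%m≡o%m d′ d b d′∣d))

double≡*2 : ∀ r → r + r ≡ r * 2
double≡*2 r = trans (cong (r +_) (sym (+-identityʳ r))) (*-comm 2 r)

double-injective : ∀ {a b} → a + a ≡ b + b → a ≡ b
double-injective {a} {b} a+a≡b+b = *-cancelʳ-≡ a b 2 (trans (sym (double≡*2 a)) (trans a+a≡b+b (double≡*2 b)))

odd≢double : ∀ {t} → ¬ 2 ∣ t → ∀ r → r + r ≢ t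
odd≢double 2∤t r r+r≡t = 2∤t (divides r (trans (sym r+r≡t) (double≡*2 r)))

half< : ∀ {u v} .{{_ : NonZero v}} → u + u ≡ v → u < v
half< {zero}  {v} 0≡v  = contradiction (sym 0≡v) (≢-nonZero⁻¹ v)
half< {suc u}     refl = m<m+n (suc u) z<s

+-double-< : ∀ {a b t} → a + a < t → b + b < t → a + b < t
+-double-< {a} {b} a+a<t b+b<t with ≤-total a b
... | inj₁ a≤b = ≤-<-trans (+-monoˡ-≤ b a≤b) b+b<t
... | inj₂ b≤a = ≤-<-trans (+-monoʳ-≤ a b≤a) a+a<t

∸-double-< : ∀ {r t} → r ≤ t → t < r + r → (t ∸ r) + (t ∸ r) < t
∸-double-< {r} {t} r≤t t<r+r = begin-strict
  (t ∸ r) + (t ∸ r)  <⟨ +-monoʳ-< (t ∸ r) t∸r<r ⟩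
  (t ∸ r) + r        ≡⟨ m∸n+n≡m r≤t ⟩
  t                  ∎
  where
  open ≤-Reasoning
  t∸r<r : t ∸ r < r
  t∸r<r = +-cancelʳ-< r (t ∸ r) r (subst (_< r + r) (sym (m∸n+n≡m r≤t)) t<r+r)

odd⇒%2≡1 : ∀ {m} → ¬ 2 ∣ m → m % 2 ≡ 1
odd⇒%2≡1 {m} 2∤m with m % 2 in eq | m%n<n m 2
... | 0           | _ = contradiction (m%n≡0⇒n∣m m 2 eq) 2∤m
... | 1           | _ = refl
... | suc (suc _) | s≤s (s≤s ())

odd⇒≡1+2q : ∀ {m} → ¬ 2 ∣ m → m ≡ 1 + m / 2 * 2
odd⇒≡1+2q {m} 2∤m = trans (m≡m%n+[m/n]*n m 2) (cong (_+ m / 2 * 2) (odd⇒%2≡1 2∤m))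

-- q = q * m ∸ (m / 2) * (q + q) when m is odd
odd∣double⇒∣ : ∀ {m q} → ¬ 2 ∣ m → m ∣ q + q → m ∣ q
odd∣double⇒∣ {m} {q} 2∤m m∣q+q = ∣m+n∣m⇒∣n (subst (m ∣_) q*m≡ (n∣m*n q)) (∣n⇒∣m*n (m / 2) m∣q+q)
  where
  expand : ∀ q j → q * (1 + j * 2) ≡ j * (q + q) + q
  expand = solve-∀
  q*m≡ : q * m ≡ m / 2 * (q + q) + q
  q*m≡ = trans (cong (q *_) (odd⇒≡1+2q 2∤m)) (expand q (m / 2))

odd-quotient-∣-double : ∀ {t m i} .{{_ : NonZero t}} → ¬ 2 ∣ m → t ∣ i → t * m ∣ i + i → t * m ∣ i
odd-quotient-∣-double {t} {m} {i} 2∤m (divides q refl) tm∣i+i =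
  subst (_∣ q * t) (*-comm m t) (*-monoˡ-∣ t (odd∣double⇒∣ {q = q} 2∤m m∣q+q))
  where
  m∣q+q : m ∣ q + q
  m∣q+q = *-cancelʳ-∣ {n = q + q} t (subst₂ _∣_ (*-comm t m) (sym (*-distribʳ-+ t q q)) tm∣i+i)

-- i + i and n are multiples of 2t, so i + i ≡ t (mod n) would make t one as well
double-multiple≉ : ∀ {t n i} .{{_ : NonZero t}} .{{_ : NonZero n}} → t * 2 ∣ n → t ∣ i → ¬ (i + i ≋⟨ n ⟩ t)
double-multiple≉ {t} {n} {i} 2t∣n (divides q refl) i+i≋t = <⇒≱ t<2t (∣⇒≤ 2t∣t)
  where
  2t∣i+i : t * 2 ∣ i + i
  2t∣i+i = divides q (regroup q t)
    where
    regroup : ∀ q t → q * t + q * t ≡ q * (t * 2)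
    regroup = solve-∀
  2t∣t : t * 2 ∣ t
  2t∣t = ∣n∣m%n⇒∣m 2t∣n (subst (t * 2 ∣_) i+i≋t (%-presˡ-∣ 2t∣i+i 2t∣n))
  t<2t : t < t * 2
  t<2t = m<m*n t 2 (s≤s (s≤s z≤n))

module Rotations (n : ℕ) .{{_ : NonZero n}} where

  infixl 6 _⊕_
  infix  8 ⊖_

  _⊕_ : Fin n → Fin n → Fin n
  i ⊕ j = (toℕ i + toℕ j) mod n

  ⊖_ : Fin n → Fin n
  ⊖ i = (n ∸ toℕ i) mod n

  𝟘 : Fin n
  𝟘 = 0 mod n

  toℕ-mod : ∀ x → toℕ (x mod n) ≡ x % n
  toℕ-mod x = toℕ-fromℕ< (m%n<n x n)

  toℕ-mod-≋ : ∀ x → toℕ (x mod n) ≋⟨ n ⟩ x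
  toℕ-mod-≋ x = trans (cong (_% n) (toℕ-mod x)) (m%d≋m x)

  toℕ-𝟘 : toℕ 𝟘 ≡ 0
  toℕ-𝟘 = trans (toℕ-mod 0) 0%d≡0

  toℕ≡0⇒≡𝟘 : ∀ {i} → toℕ i ≡ 0 → i ≡ 𝟘
  toℕ≡0⇒≡𝟘 toℕi≡0 = toℕ-injective (trans toℕi≡0 (sym toℕ-𝟘))

  toℕ-injective-≋ : ∀ {i j} → toℕ i ≋⟨ n ⟩ toℕ j → i ≡ j
  toℕ-injective-≋ {i} {j} i≋j = toℕ-injective (<-≋⇒≡ (toℕ<n i) (toℕ<n j) i≋j)

  toℕ-⊕ : ∀ i j → toℕ (i ⊕ j) ≋⟨ n ⟩ toℕ i + toℕ j
  toℕ-⊕ i j = toℕ-mod-≋ (toℕ i + toℕ j)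

  toℕ-⊖ : ∀ i → toℕ (⊖ i) + toℕ i ≋⟨ n ⟩ 0
  toℕ-⊖ i = trans (+-cong-≋ (toℕ-mod-≋ (n ∸ toℕ i)) refl) (d∸x+x≋0 (<⇒≤ (toℕ<n i)))

  ⊕-⊖-isAbelianGroup : IsAbelianGroup _≡_ _⊕_ 𝟘 ⊖_
  ⊕-⊖-isAbelianGroup = record
    { isGroup = record
      { isMonoid = record
        { isSemigroup = record
          { isMagma = record { isEquivalence = isEquivalence ; ∙-cong = cong₂ _⊕_ }
          ; assoc   = assoc
          }
        ; identity = identityˡ , identityʳ
        }
      ; inverse = inverseˡ , inverseʳ
      ; ⁻¹-cong = cong ⊖_
      }
    ; comm = comm
    }
    where
    assoc : ∀ i j k → i ⊕ j ⊕ k ≡ i ⊕ (j ⊕ k)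
    assoc i j k = toℕ-injective-≋ (begin
      toℕ (i ⊕ j ⊕ k) % n              ≡⟨ toℕ-⊕ (i ⊕ j) k ⟩
      (toℕ (i ⊕ j) + toℕ k) % n        ≡⟨ +-cong-≋ (toℕ-⊕ i j) refl ⟩
      (toℕ i + toℕ j + toℕ k) % n      ≡⟨ cong (_% n) (+-assoc (toℕ i) (toℕ j) (toℕ k)) ⟩
      (toℕ i + (toℕ j + toℕ k)) % n    ≡⟨ +-cong-≋ {a = toℕ i} refl (toℕ-⊕ j k) ⟨
      (toℕ i + toℕ (j ⊕ k)) % n        ≡⟨ toℕ-⊕ i (j ⊕ k) ⟨
      toℕ (i ⊕ (j ⊕ k)) % n            ∎)
      where open ≡-Reasoning
    comm : ∀ i j → i ⊕ j ≡ j ⊕ i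
    comm i j = cong (_mod n) (+-comm (toℕ i) (toℕ j))
    identityˡ : ∀ i → 𝟘 ⊕ i ≡ i
    identityˡ i = toℕ-injective-≋ (trans (toℕ-⊕ 𝟘 i) (cong (λ x → (x + toℕ i) % n) toℕ-𝟘))
    identityʳ : ∀ i → i ⊕ 𝟘 ≡ i
    identityʳ i = trans (comm i 𝟘) (identityˡ i)
    inverseˡ : ∀ i → ⊖ i ⊕ i ≡ 𝟘
    inverseˡ i = toℕ-injective-≋ (trans (toℕ-⊕ (⊖ i) i) (trans (toℕ-⊖ i) (cong (_% n) (sym toℕ-𝟘))))
    inverseʳ : ∀ i → i ⊕ ⊖ i ≡ 𝟘
    inverseʳ i = trans (comm i (⊖ i)) (inverseˡ i)

  rotationGroup : AbelianGroup 0ℓ 0ℓ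
  rotationGroup = record { isAbelianGroup = ⊕-⊖-isAbelianGroup }

  open IsAbelianGroup ⊕-⊖-isAbelianGroup public
    using (assoc; comm; identityˡ; identityʳ; inverseˡ; inverseʳ)
  open import Algebra.Properties.AbelianGroup rotationGroup public
    using (xyx⁻¹≈y; x∙y⁻¹≈ε⇒x≈y; \\-leftDividesˡ; \\-leftDividesʳ)
    renaming (⁻¹-involutive to ⊖-involutive; ⁻¹-injective to ⊖-injective; ε⁻¹≈ε to ⊖𝟘≡𝟘;
              ⁻¹-∙-comm to ⊖-⊕-distrib)

  ⊖-⊖⊕ : ∀ k i → ⊖ (⊖ k ⊕ i) ≡ k ⊕ ⊖ i
  ⊖-⊖⊕ k i = trans (sym (⊖-⊕-distrib (⊖ k) i)) (cong (_⊕ ⊖ i) (⊖-involutive k))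

  mirror : Fin n → Fin n → Fin n
  mirror x i = x ⊕ (x ⊕ ⊖ i)

  mirror-self : ∀ x → mirror x x ≡ x
  mirror-self x = trans (cong (x ⊕_) (inverseʳ x)) (identityʳ x)

  mirror-fixed : ∀ {x i} → mirror x i ≡ i → i ⊕ i ≡ x ⊕ x
  mirror-fixed {x} {i} fixed = begin
    i ⊕ i                  ≡⟨ cong (_⊕ i) fixed ⟨
    x ⊕ (x ⊕ ⊖ i) ⊕ i      ≡⟨ assoc x (x ⊕ ⊖ i) i ⟩
    x ⊕ (x ⊕ ⊖ i ⊕ i)      ≡⟨ cong (x ⊕_) (assoc x (⊖ i) i) ⟩
    x ⊕ (x ⊕ (⊖ i ⊕ i))    ≡⟨ cong (λ y → x ⊕ (x ⊕ y)) (inverseˡ i) ⟩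
    x ⊕ (x ⊕ 𝟘)            ≡⟨ cong (x ⊕_) (identityʳ x) ⟩
    x ⊕ x                  ∎
    where open ≡-Reasoning

  ⊖-mirror : ∀ x i → x ⊕ ⊖ mirror x i ≡ ⊖ (x ⊕ ⊖ i)
  ⊖-mirror x i = trans (cong (x ⊕_) (sym (⊖-⊕-distrib x (x ⊕ ⊖ i)))) (\\-leftDividesˡ x (⊖ (x ⊕ ⊖ i)))

  mirror-⊖ : ∀ x i → mirror x i ⊕ ⊖ x ≡ ⊖ (i ⊕ ⊖ x)
  mirror-⊖ x i = trans (xyx⁻¹≈y x (x ⊕ ⊖ i)) (sym (trans (cong ⊖_ (comm i (⊖ x))) (⊖-⊖⊕ x i)))

  ⊖-half : ∀ {u} (u+u≡n : u + u ≡ n) → ⊖ fromℕ< (half< {u} u+u≡n) ≡ fromℕ< (half< {u} u+u≡n)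
  ⊖-half {u} u+u≡n = toℕ-injective (begin
    toℕ (⊖ fromℕ< u<n)                  ≡⟨ toℕ-mod (n ∸ toℕ (fromℕ< u<n)) ⟩
    (n ∸ toℕ (fromℕ< u<n)) % n          ≡⟨ cong (λ v → (n ∸ v) % n) (toℕ-fromℕ< u<n) ⟩
    (n ∸ u) % n                         ≡⟨ cong (λ v → (v ∸ u) % n) u+u≡n ⟨
    (u + u ∸ u) % n                     ≡⟨ cong (_% n) (m+n∸n≡m u u) ⟩
    u % n                               ≡⟨ m<n⇒m%n≡m u<n ⟩
    u                                   ≡⟨ toℕ-fromℕ< u<n ⟨
    toℕ (fromℕ< u<n)                    ∎)
    where
    open ≡-Reasoning
    u<n = half< {u} u+u≡n

module Cosets (n t : ℕ) .{{_ : NonZero n}} .{{_ : NonZero t}} (t∣n : t ∣ n) where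
  open Rotations n

  t≤n : t ≤ n
  t≤n = ∣⇒≤ t∣n

  Multiple : Fin n → Set
  Multiple i = t ∣ toℕ i

  infix 4 _∼_
  _∼_ : Fin n → Fin n → Set
  i ∼ j = toℕ i ≋⟨ t ⟩ toℕ j

  toℕ-⊕-≋ₜ : ∀ i j → toℕ (i ⊕ j) ≋⟨ t ⟩ toℕ i + toℕ j
  toℕ-⊕-≋ₜ i j = ≋-∣-weaken t∣n (toℕ-⊕ i j)

  toℕ-⊖-≋ₜ : ∀ i → toℕ (⊖ i) + toℕ i ≋⟨ t ⟩ 0
  toℕ-⊖-≋ₜ i = ≋-∣-weaken t∣n (toℕ-⊖ i)

  ∼-⊖ : ∀ {i j} → i ∼ j → ⊖ i ∼ ⊖ j
  ∼-⊖ {i} {j} i∼j = +-cancelʳ-≋ (toℕ i)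
    (trans (toℕ-⊖-≋ₜ i) (sym (trans (+-cong-≋ {a = toℕ (⊖ j)} refl i∼j) (toℕ-⊖-≋ₜ j))))

  Multiple-𝟘 : Multiple 𝟘
  Multiple-𝟘 = subst (t ∣_) (sym toℕ-𝟘) (t ∣0)

  Multiple-⊕ : ∀ {i j} → Multiple i → Multiple j → Multiple (i ⊕ j)
  Multiple-⊕ {i} {j} t∣i t∣j = ≋0⇒∣ (trans (toℕ-⊕-≋ₜ i j) (+-cong-≋ (∣⇒≋0 t∣i) (∣⇒≋0 t∣j)))

  Multiple-⊖ : ∀ {i} → Multiple i → Multiple (⊖ i)
  Multiple-⊖ {i} t∣i = ≋0⇒∣ (+-cancelʳ-≋ (toℕ i) (trans (toℕ-⊖-≋ₜ i) (sym (∣⇒≋0 t∣i))))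

  Multiple-mirror : ∀ {x i} → Multiple (x ⊕ x) → Multiple i → Multiple (mirror x i)
  Multiple-mirror {x} {i} t∣x⊕x t∣i = subst Multiple (assoc x x (⊖ i)) (Multiple-⊕ t∣x⊕x (Multiple-⊖ t∣i))

  ⊕-Multiple-∼ : ∀ {k j} → Multiple j → k ⊕ j ∼ k
  ⊕-Multiple-∼ {k} {j} t∣j =
    trans (toℕ-⊕-≋ₜ k j) (trans (+-cong-≋ {a = toℕ k} refl (∣⇒≋0 t∣j)) (cong (_% t) (+-identityʳ (toℕ k))))

  ∼⇒Multiple : ∀ {w k} → w ∼ k → Multiple (⊖ k ⊕ w)
  ∼⇒Multiple {w} {k} w∼k =
    ≋0⇒∣ (trans (toℕ-⊕-≋ₜ (⊖ k) w) (trans (+-cong-≋ {a = toℕ (⊖ k)} refl w∼k) (toℕ-⊖-≋ₜ k)))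

  record IsTransversal (R : Fin n → Set) : Set where
    field
      representative : ∀ k → ∃ λ w → R w × w ∼ k
      unique         : ∀ {w w′} → R w → R w′ → w ∼ w′ → w ≡ w′

  ∃!-translate : ∀ {R} → IsTransversal R → ∀ k → ∃! _≡_ (λ i → Multiple i × R (k ⊕ i))
  ∃!-translate {R} R-transversal k =
    ⊖ k ⊕ w , (∼⇒Multiple w∼k , subst R (sym (\\-leftDividesˡ k w)) Rw) , uniqueness
    where
    open IsTransversal R-transversal
    w = proj₁ (representative k)
    Rw = proj₁ (proj₂ (representative k))
    w∼k = proj₂ (proj₂ (representative k))
    uniqueness : ∀ {j} → Multiple j × R (k ⊕ j) → ⊖ k ⊕ w ≡ j
    uniqueness {j} (t∣j , R[k⊕j]) = begin
      ⊖ k ⊕ w         ≡⟨ cong (⊖ k ⊕_) (unique Rw R[k⊕j] (trans w∼k (sym (⊕-Multiple-∼ t∣j)))) ⟩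
      ⊖ k ⊕ (k ⊕ j)   ≡⟨ \\-leftDividesʳ k j ⟩
      j               ∎
      where open ≡-Reasoning

  Low : Fin n → Set
  Low v = toℕ v < t

  low-isTransversal : IsTransversal Low
  low-isTransversal = record
    { representative = λ k → let r<t = m%n<n (toℕ k) t in
        fromℕ< (<-≤-trans r<t t≤n) ,
        subst (_< t) (sym (toℕ-fromℕ< _)) r<t ,
        trans (cong (_% t) (toℕ-fromℕ< _)) (m%d≋m (toℕ k))
    ; unique = λ w<t w′<t w∼w′ → toℕ-injective (<-≋⇒≡ w<t w′<t w∼w′)
    }

  -- |v| < t/2, reading v as a signed residue
  Short : Fin n → Set
  Short v = toℕ v + toℕ v < t ⊎ toℕ (⊖ v) + toℕ (⊖ v) < t

  short-⊖ : ∀ {v} → Short v → Short (⊖ v)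
  short-⊖ {v} (inj₁ v-low) = inj₂ (subst (λ u → toℕ u + toℕ u < t) (sym (⊖-involutive v)) v-low)
  short-⊖ (inj₂ ⊖v-low)    = inj₁ ⊖v-low

  short-unique : ∀ {w w′} → Short w → Short w′ → w ∼ w′ → w ≡ w′
  short-unique (inj₁ w-low)  (inj₁ w′-low)  w∼w′ = toℕ-injective (<-≋⇒≡ (double<⇒< w-low) (double<⇒< w′-low) w∼w′)
    where
    double<⇒< : ∀ {a} → a + a < t → a < t
    double<⇒< {a} = ≤-<-trans (m≤m+n a a)
  short-unique (inj₂ ⊖w-low) (inj₂ ⊖w′-low) w∼w′ =
    ⊖-injective (short-unique (inj₁ ⊖w-low) (inj₁ ⊖w′-low) (∼-⊖ w∼w′))
  short-unique (inj₁ w-low)  (inj₂ ⊖w′-low) w∼w′ = opposite w-low ⊖w′-low w∼w′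
    where
    -- toℕ w + toℕ (⊖ w′) is a multiple of t below t, so both summands vanish
    opposite : ∀ {w w′} → toℕ w + toℕ w < t → toℕ (⊖ w′) + toℕ (⊖ w′) < t → w ∼ w′ → w ≡ w′
    opposite {w} {w′} w-low ⊖w′-low w∼w′ = trans (toℕ≡0⇒≡𝟘 (m+n≡0⇒m≡0 _ sum≡0)) (sym w′≡𝟘)
      where
      sum≡0 : toℕ w + toℕ (⊖ w′) ≡ 0
      sum≡0 = <-≋⇒≡ (+-double-< {toℕ w} {toℕ (⊖ w′)} w-low ⊖w′-low) (>-nonZero⁻¹ t)
        (trans (+-cong-≋ w∼w′ refl) (trans (cong (_% t) (+-comm (toℕ w′) _)) (toℕ-⊖-≋ₜ w′)))
      w′≡𝟘 : w′ ≡ 𝟘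
      w′≡𝟘 = ⊖-injective (trans (toℕ≡0⇒≡𝟘 (m+n≡0⇒n≡0 (toℕ w) sum≡0)) (sym ⊖𝟘≡𝟘))
  short-unique (inj₂ ⊖w-low) (inj₁ w′-low)  w∼w′ = sym (short-unique (inj₁ w′-low) (inj₂ ⊖w-low) (sym w∼w′))

  short-representative : ∀ k → toℕ k % t + toℕ k % t ≢ t → ∃ λ w → Short w × w ∼ k
  short-representative k r+r≢t with <-cmp (toℕ k % t + toℕ k % t) t
  ... | tri< r+r<t _ _ = fromℕ< r<n , inj₁ (subst (λ u → u + u < t) (sym (toℕ-fromℕ< r<n)) r+r<t) ,
                         trans (cong (_% t) (toℕ-fromℕ< r<n)) (m%d≋m (toℕ k))
    where
    r<n : toℕ k % t < n
    r<n = <-≤-trans (m%n<n (toℕ k) t) t≤n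
  ... | tri≈ _ r+r≡t _ = contradiction r+r≡t r+r≢t
  ... | tri> _ _ t<r+r = ⊖ v , inj₂ (subst (λ u → toℕ u + toℕ u < t) (sym (⊖-involutive v)) v-low) , ⊖v∼k
    where
    r = toℕ k % t
    r≤t = <⇒≤ (m%n<n (toℕ k) t)
    s-low : (t ∸ r) + (t ∸ r) < t
    s-low = ∸-double-< r≤t t<r+r
    v<n : t ∸ r < n
    v<n = <-≤-trans (≤-<-trans (m≤m+n (t ∸ r) (t ∸ r)) s-low) t≤n
    v : Fin n
    v = fromℕ< v<n
    v-low : toℕ v + toℕ v < t
    v-low = subst (λ u → u + u < t) (sym (toℕ-fromℕ< v<n)) s-low
    -- both sides become ≡ 0 after adding t ∸ r
    ⊖v∼k : ⊖ v ∼ k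
    ⊖v∼k = +-cancelʳ-≋ (t ∸ r) (begin
      (toℕ (⊖ v) + (t ∸ r)) % t   ≡⟨ cong (λ u → (toℕ (⊖ v) + u) % t) (toℕ-fromℕ< v<n) ⟨
      (toℕ (⊖ v) + toℕ v) % t     ≡⟨ toℕ-⊖-≋ₜ v ⟩
      0 % t                       ≡⟨ 0%d≡0 ⟩
      0                           ≡⟨ n%n≡0 t ⟨
      t % t                       ≡⟨ cong (_% t) (m∸n+n≡m r≤t) ⟨
      (t ∸ r + r) % t             ≡⟨ cong (_% t) (+-comm (t ∸ r) r) ⟩
      (r + (t ∸ r)) % t           ≡⟨ +-cong-≋ (m%d≋m (toℕ k)) refl ⟩
      (toℕ k + (t ∸ r)) % t       ∎)
      where open ≡-Reasoning

  -- Short meets every class once except that of t/2 (for even t), which it misses; the self-inverse centre c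
  -- replaces whatever Short has in its own class.
  module _ (c : Fin n) (⊖c≡c : ⊖ c ≡ c) (centre-class : ∀ k → toℕ k % t + toℕ k % t ≡ t → k ∼ c) where

    WithCentre : Fin n → Set
    WithCentre v = (Short v × ¬ v ∼ c) ⊎ v ≡ c

    withCentre-isTransversal : IsTransversal WithCentre
    withCentre-isTransversal = record { representative = representative ; unique = unique }
      where
      representative : ∀ k → ∃ λ w → WithCentre w × w ∼ k
      representative k with toℕ k % t ≟ toℕ c % t
      ... | yes k∼c = c , inj₂ refl , sym k∼c
      ... | no  k≁c =
        let (w , short-w , w∼k) = short-representative k (k≁c ∘ centre-class k)
        in  w , inj₁ (short-w , λ w∼c → k≁c (trans (sym w∼k) w∼c)) , w∼k
      unique : ∀ {w w′} → WithCentre w → WithCentre w′ → w ∼ w′ → w ≡ w′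
      unique (inj₁ (short-w , _))  (inj₁ (short-w′ , _)) w∼w′ = short-unique short-w short-w′ w∼w′
      unique (inj₁ (_ , w≁c))      (inj₂ refl)           w∼c  = contradiction w∼c w≁c
      unique (inj₂ refl)           (inj₁ (_ , w′≁c))     c∼w′ = contradiction (sym c∼w′) w′≁c
      unique (inj₂ refl)           (inj₂ refl)           _    = refl

    withCentre-⊖ : ∀ {v} → WithCentre v → WithCentre (⊖ v)
    withCentre-⊖ {v} (inj₁ (short-v , v≁c)) =
      inj₁ (short-⊖ {v} short-v , λ ⊖v∼c → v≁c (subst₂ _∼_ (⊖-involutive v) ⊖c≡c (∼-⊖ ⊖v∼c)))
    withCentre-⊖ (inj₂ refl) = inj₂ ⊖c≡c

∃!-map : ∀ {A : Set} {P Q : A → Set} → (∀ {x} → P x → Q x) → (∀ {x} → Q x → P x) → ∃! _≡_ P → ∃! _≡_ Q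
∃!-map P⇒Q Q⇒P (x , Px , unique) = x , P⇒Q Px , unique ∘ Q⇒P

module DihedralCodes (n t : ℕ) .{{_ : NonZero n}} .{{_ : NonZero t}} (t∣n : t ∣ n) where
  open Dihedral n
  open Rotations n
  open Cosets n t t∣n

  pow-rotation : ∀ r k → pow (r , false) k ≡ ((k * toℕ r) mod n , false)
  pow-rotation r zero    = refl
  pow-rotation r (suc k) = trans (cong (_· (r , false)) (pow-rotation r k)) (cong (_, false) (toℕ-injective-≋ (begin
    toℕ ((k * toℕ r) mod n ⊕ r) % n       ≡⟨ toℕ-⊕ _ r ⟩
    (toℕ ((k * toℕ r) mod n) + toℕ r) % n ≡⟨ +-cong-≋ (toℕ-mod-≋ (k * toℕ r)) refl ⟩
    (k * toℕ r + toℕ r) % n               ≡⟨ cong (_% n) (+-comm (k * toℕ r) (toℕ r)) ⟩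
    (suc k * toℕ r) % n                   ≡⟨ toℕ-mod-≋ (suc k * toℕ r) ⟨
    toℕ ((suc k * toℕ r) mod n) % n       ∎)))
    where open ≡-Reasoning

  pow-a : ∀ k → pow a k ≡ (k mod n , false)
  pow-a k = trans (pow-rotation (1 mod n) k) (cong (_, false) (toℕ-injective-≋ (begin
    toℕ ((k * toℕ (1 mod n)) mod n) % n   ≡⟨ toℕ-mod-≋ (k * toℕ (1 mod n)) ⟩
    (k * toℕ (1 mod n)) % n               ≡⟨ *-congˡ-≋ k (toℕ-mod-≋ 1) ⟩
    (k * 1) % n                           ≡⟨ cong (_% n) (*-identityʳ k) ⟩
    k % n                                 ≡⟨ toℕ-mod-≋ k ⟨
    toℕ (k mod n) % n                     ∎)))
    where open ≡-Reasoning

  t∣toℕ-a^t : t ∣ toℕ (t mod n)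
  t∣toℕ-a^t = subst (t ∣_) (sym (toℕ-mod t)) (%-presˡ-∣ ∣-refl t∣n)

  ⟨a^t⟩⇒Multiple : ∀ {i s} → ⟨ pow a t ⟩ (i , s) → s ≡ false × Multiple i
  ⟨a^t⟩⇒Multiple {i} (k , eq) with trans eq (trans (cong (λ g → pow g k) (pow-a t)) (pow-rotation (t mod n) k))
  ... | refl = refl , subst (t ∣_) (sym (toℕ-mod _)) (%-presˡ-∣ (∣n⇒∣m*n k t∣toℕ-a^t) t∣n)

  Multiple⇒⟨a^t⟩ : ∀ {i} → Multiple i → ⟨ pow a t ⟩ (i , false)
  Multiple⇒⟨a^t⟩ {i} (divides q toℕi≡q*t) =
    q , trans (cong (_, false) (toℕ-injective-≋ toℕi≋)) (sym (trans (cong (λ g → pow g q) (pow-a t)) (pow-rotation (t mod n) q)))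
    where
    toℕi≋ : toℕ i ≋⟨ n ⟩ toℕ ((q * toℕ (t mod n)) mod n)
    toℕi≋ = sym (trans (toℕ-mod-≋ _) (trans (*-congˡ-≋ q (toℕ-mod-≋ t)) (cong (_% n) (sym toℕi≡q*t))))

  exactlyOne⇔∃!Multiple : ∀ {Q : D n → Set} →
    ExactlyOne (λ c → ⟨ pow a t ⟩ c × Q c) ⇔ ∃! _≡_ (λ i → Multiple i × Q (i , false))
  exactlyOne⇔∃!Multiple {Q} = mk⇔ to from
    where
    to : ExactlyOne (λ c → ⟨ pow a t ⟩ c × Q c) → ∃! _≡_ (λ i → Multiple i × Q (i , false))
    to ((i , s) , (i∈H , Qc) , unique) with ⟨a^t⟩⇒Multiple i∈H
    ... | refl , t∣i = i , (t∣i , Qc) , λ (t∣j , Qj) → cong proj₁ (sym (unique _ (Multiple⇒⟨a^t⟩ t∣j , Qj)))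
    from : ∃! _≡_ (λ i → Multiple i × Q (i , false)) → ExactlyOne (λ c → ⟨ pow a t ⟩ c × Q c)
    from (i , (t∣i , Qi) , unique) = (i , false) , (Multiple⇒⟨a^t⟩ t∣i , Qi) , only
      where
      only : ∀ c → ⟨ pow a t ⟩ c × Q c → c ≡ (i , false)
      only (j , s) (j∈H , Qc) with ⟨a^t⟩⇒Multiple j∈H
      ... | refl , t∣j = cong (_, false) (sym (unique (t∣j , Qc)))

  reflection-·-rotation⁻¹ : ∀ k i → (k , true) · ((i , false) ⁻¹) ≡ (k ⊕ i , true)
  reflection-·-rotation⁻¹ k i = cong (_, true) (toℕ-injective-≋ (begin
    toℕ ((toℕ k + (n ∸ toℕ (⊖ i))) mod n) % n   ≡⟨ toℕ-mod-≋ _ ⟩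
    (toℕ k + (n ∸ toℕ (⊖ i))) % n               ≡⟨ +-cong-≋ {a = toℕ k} refl (toℕ-mod-≋ (n ∸ toℕ (⊖ i))) ⟨
    (toℕ k + toℕ (⊖ ⊖ i)) % n                   ≡⟨ cong (λ j → (toℕ k + toℕ j) % n) (⊖-involutive i) ⟩
    (toℕ k + toℕ i) % n                         ≡⟨ toℕ-⊕ k i ⟨
    toℕ (k ⊕ i) % n                             ∎))
    where open ≡-Reasoning

  module _ {R : Fin n → Set} (R-transversal : IsTransversal R) (R-⊖ : ∀ {w} → R w → R (⊖ w)) where

    R-⊖⁻¹ : ∀ {w} → R (⊖ w) → R w
    R-⊖⁻¹ {w} = subst R (⊖-involutive w) ∘ R-⊖

    perfectCode-of-transversal : R 𝟘 → IsPerfectCode ⟨ pow a t ⟩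
    perfectCode-of-transversal R𝟘 = S , ((λ (_ , 𝟘≢𝟘) → 𝟘≢𝟘 refl) , S-⁻¹) , perfect
      where
      S : D n → Set
      S (v , false) = R v × ¬ 𝟘 ≡ v
      S (v , true)  = Low v
      S-⁻¹ : ∀ x → S x → S (x ⁻¹)
      S-⁻¹ (v , false) (Rv , 𝟘≢v) = R-⊖ Rv , λ 𝟘≡⊖v → 𝟘≢v (⊖-injective (trans ⊖𝟘≡𝟘 𝟘≡⊖v))
      S-⁻¹ (v , true)  v-low      = v-low
      perfect : IsPerfectCodeIn S ⟨ pow a t ⟩
      perfect (k , false) = Equivalence.from exactlyOne⇔∃!Multiple
        (∃!-map (map₂ toRotation) (map₂ fromRotation) (∃!-translate R-transversal (⊖ k)))
        where
        toRotation : ∀ {i} → R (⊖ k ⊕ i) → (k , false) ≡ (i , false) ⊎ S (k ⊕ ⊖ i , false)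
        toRotation {i} R[⊖k⊕i] with 𝟘 ≟ᶠ k ⊕ ⊖ i
        ... | yes 𝟘≡k⊖i = inj₁ (cong (_, false) (x∙y⁻¹≈ε⇒x≈y k i (sym 𝟘≡k⊖i)))
        ... | no  𝟘≢k⊖i = inj₂ (subst R (⊖-⊖⊕ k i) (R-⊖ R[⊖k⊕i]) , 𝟘≢k⊖i)
        fromRotation : ∀ {i} → (k , false) ≡ (i , false) ⊎ S (k ⊕ ⊖ i , false) → R (⊖ k ⊕ i)
        fromRotation (inj₁ refl)      = subst R (sym (inverseˡ k)) R𝟘
        fromRotation {i} (inj₂ (R[k⊖i] , _)) = R-⊖⁻¹ (subst R (sym (⊖-⊖⊕ k i)) R[k⊖i])
      perfect (k , true) = Equivalence.from exactlyOne⇔∃!Multiple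
        (∃!-map (map₂ toReflection) (map₂ fromReflection) (∃!-translate low-isTransversal k))
        where
        toReflection : ∀ {i} → Low (k ⊕ i) → (k , true) ≡ (i , false) ⊎ S ((k , true) · ((i , false) ⁻¹))
        toReflection {i} low = inj₂ (subst S (sym (reflection-·-rotation⁻¹ k i)) low)
        fromReflection : ∀ {i} → (k , true) ≡ (i , false) ⊎ S ((k , true) · ((i , false) ⁻¹)) → Low (k ⊕ i)
        fromReflection {i} (inj₂ s) = subst S (reflection-·-rotation⁻¹ k i) s

    totalPerfectCode-of-transversal : ¬ R 𝟘 → IsTotalPerfectCode ⟨ pow a t ⟩
    totalPerfectCode-of-transversal ¬R𝟘 = S , (¬R𝟘 , S-⁻¹) , totallyPerfect
      where
      S : D n → Set
      S (v , false) = R v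
      S (v , true)  = Low v
      S-⁻¹ : ∀ x → S x → S (x ⁻¹)
      S-⁻¹ (v , false) = R-⊖
      S-⁻¹ (v , true)  = λ v-low → v-low
      totallyPerfect : IsTotalPerfectCodeIn S ⟨ pow a t ⟩
      totallyPerfect (k , false) = Equivalence.from exactlyOne⇔∃!Multiple
        (∃!-map (map₂ (subst R (comm (⊖ k) _))) (map₂ (subst R (comm _ (⊖ k))))
                (∃!-translate R-transversal (⊖ k)))
      totallyPerfect (k , true) = Equivalence.from exactlyOne⇔∃!Multiple
        (∃!-map (map₂ (subst Low (comm k _))) (map₂ (subst Low (comm _ k)))
                (∃!-translate low-isTransversal k))

  ∃!-mirror-fixed : ∀ {P : Fin n → Set} {x} → Multiple (x ⊕ x) → ∃! _≡_ (λ i → Multiple i × P i) →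
    (∀ {i} → P i → P (mirror x i)) → ∃ λ i → Multiple i × P i × i ⊕ i ≡ x ⊕ x
  ∃!-mirror-fixed t∣x⊕x (i , (t∣i , Pi) , unique) P-mirror =
    i , t∣i , Pi , mirror-fixed (sym (unique (Multiple-mirror t∣x⊕x t∣i , P-mirror Pi)))

  perfectCode-mirror-fixed : IsPerfectCode ⟨ pow a t ⟩ → ∀ x → Multiple (x ⊕ x) → ∃ λ i → Multiple i × i ⊕ i ≡ x ⊕ x
  perfectCode-mirror-fixed (S , (_ , S-⁻¹) , perfect) x t∣x⊕x =
    let (i , t∣i , _ , i⊕i≡x⊕x) = ∃!-mirror-fixed t∣x⊕x (Equivalence.to exactlyOne⇔∃!Multiple (perfect (x , false))) S-mirror
    in  i , t∣i , i⊕i≡x⊕x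
    where
    S-mirror : ∀ {i} → (x , false) ≡ (i , false) ⊎ S (x ⊕ ⊖ i , false) →
      (x , false) ≡ (mirror x i , false) ⊎ S (x ⊕ ⊖ mirror x i , false)
    S-mirror (inj₁ refl)    = inj₁ (cong (_, false) (sym (mirror-self x)))
    S-mirror {i} (inj₂ Sxi) = inj₂ (subst S (cong (_, false) (sym (⊖-mirror x i))) (S-⁻¹ _ Sxi))

  totalPerfectCode-mirror-fixed : ∀ {S} → IsConnectionSet S → IsTotalPerfectCodeIn S ⟨ pow a t ⟩ →
    ∀ x → Multiple (x ⊕ x) → ∃ λ i → Multiple i × S (i ⊕ ⊖ x , false) × i ⊕ i ≡ x ⊕ x
  totalPerfectCode-mirror-fixed {S} (_ , S-⁻¹) totallyPerfect x t∣x⊕x =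
    ∃!-mirror-fixed t∣x⊕x (Equivalence.to exactlyOne⇔∃!Multiple (totallyPerfect (x , false)))
      (λ {i} Sxi → subst S (cong (_, false) (sym (mirror-⊖ x i))) (S-⁻¹ _ Sxi))

  t*[n/t]≡n : t * (n / t) ≡ n
  t*[n/t]≡n = m*[n/m]≡n t∣n

  module _ (2∣t : 2 ∣ t) (2∣n/t : 2 ∣ n / t) where

    private
      h = quotient 2∣t
      h+h≡t : h + h ≡ t
      h+h≡t = trans (double≡*2 h) (sym (_∣_.equality 2∣t))
      h<n : h < n
      h<n = <-≤-trans (half< h+h≡t) t≤n
      x : Fin n
      x = fromℕ< h<n
      toℕ-x⊕x : toℕ (x ⊕ x) ≡ t % n
      toℕ-x⊕x = trans (toℕ-mod _) (cong (_% n) (trans (cong (λ v → v + v) (toℕ-fromℕ< h<n)) h+h≡t))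
      t∣x⊕x : Multiple (x ⊕ x)
      t∣x⊕x = subst (t ∣_) (sym toℕ-x⊕x) (%-presˡ-∣ ∣-refl t∣n)
      no-multiple-root : ∀ {i} → Multiple i → i ⊕ i ≢ x ⊕ x
      no-multiple-root {i} t∣i i⊕i≡x⊕x =
        double-multiple≉ 2t∣n t∣i (trans (sym (toℕ-mod _)) (trans (cong toℕ i⊕i≡x⊕x) toℕ-x⊕x))
        where
        2t∣n : t * 2 ∣ n
        2t∣n = subst (t * 2 ∣_) t*[n/t]≡n (*-monoʳ-∣ t 2∣n/t)

    even-evenQuotient-¬perfectCode : ¬ IsPerfectCode ⟨ pow a t ⟩
    even-evenQuotient-¬perfectCode code =
      let (i , t∣i , i⊕i≡x⊕x) = perfectCode-mirror-fixed code x t∣x⊕x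
      in  no-multiple-root t∣i i⊕i≡x⊕x

    even-evenQuotient-¬totalPerfectCode : ¬ IsTotalPerfectCode ⟨ pow a t ⟩
    even-evenQuotient-¬totalPerfectCode (S , connection , totallyPerfect) =
      let (i , t∣i , _ , i⊕i≡x⊕x) = totalPerfectCode-mirror-fixed connection totallyPerfect x t∣x⊕x
      in  no-multiple-root t∣i i⊕i≡x⊕x

  oddQuotient-¬totalPerfectCode : ¬ 2 ∣ n / t → ¬ IsTotalPerfectCode ⟨ pow a t ⟩
  oddQuotient-¬totalPerfectCode 2∤n/t (S , connection , totallyPerfect) =
    let (i , t∣i , S[i⊖𝟘] , i⊕i≡𝟘⊕𝟘) = totalPerfectCode-mirror-fixed connection totallyPerfect 𝟘 t∣𝟘⊕𝟘
    in  proj₁ connection (subst (λ v → S (v , false)) (trans (cong (_⊕ ⊖ 𝟘) (multiple-root≡𝟘 t∣i i⊕i≡𝟘⊕𝟘)) (inverseʳ 𝟘)) S[i⊖𝟘])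
    where
    t∣𝟘⊕𝟘 : Multiple (𝟘 ⊕ 𝟘)
    t∣𝟘⊕𝟘 = subst Multiple (sym (identityˡ 𝟘)) Multiple-𝟘
    multiple-root≡𝟘 : ∀ {i} → Multiple i → i ⊕ i ≡ 𝟘 ⊕ 𝟘 → i ≡ 𝟘
    multiple-root≡𝟘 {i} t∣i i⊕i≡𝟘⊕𝟘 = toℕ≡0⇒≡𝟘 (<-≋⇒≡ (toℕ<n i) (>-nonZero⁻¹ n) (∣⇒≋0 n∣i))
      where
      i+i≋0 : toℕ i + toℕ i ≋⟨ n ⟩ 0
      i+i≋0 = trans (sym (toℕ-mod _)) (trans (cong toℕ (trans i⊕i≡𝟘⊕𝟘 (identityˡ 𝟘))) (trans toℕ-𝟘 (sym 0%d≡0)))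
      n∣i : n ∣ toℕ i
      n∣i = subst (_∣ toℕ i) t*[n/t]≡n
              (odd-quotient-∣-double 2∤n/t t∣i (subst (_∣ toℕ i + toℕ i) (sym t*[n/t]≡n) (≋0⇒∣ i+i≋0)))

  odd-perfectCode : ¬ 2 ∣ t → IsPerfectCode ⟨ pow a t ⟩
  odd-perfectCode 2∤t = perfectCode-of-transversal
    (withCentre-isTransversal 𝟘 ⊖𝟘≡𝟘 no-middle) (withCentre-⊖ 𝟘 ⊖𝟘≡𝟘 no-middle) (inj₂ refl)
    where
    no-middle : ∀ k → toℕ k % t + toℕ k % t ≡ t → k ∼ 𝟘
    no-middle k r+r≡t = contradiction r+r≡t (odd≢double 2∤t (toℕ k % t))

  -- the half turn h * (n / t) lies in the class of h = t / 2 because n / t is odd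
  even-oddQuotient-perfectCode : 2 ∣ t → ¬ 2 ∣ n / t → IsPerfectCode ⟨ pow a t ⟩
  even-oddQuotient-perfectCode (divides h t≡h*2) 2∤n/t = perfectCode-of-transversal
    (withCentre-isTransversal c (⊖-half u+u≡n) middle) (withCentre-⊖ c (⊖-half u+u≡n) middle) (inj₁ (short-𝟘 , 𝟘≁c))
    where
    h+h≡t : h + h ≡ t
    h+h≡t = trans (double≡*2 h) (sym t≡h*2)
    u = h * (n / t)
    u+u≡n : u + u ≡ n
    u+u≡n = trans (sym (*-distribʳ-+ (n / t) h h)) (trans (cong (_* (n / t)) h+h≡t) t*[n/t]≡n)
    c : Fin n
    c = fromℕ< (half< {u} u+u≡n)
    expand : ∀ h j → h * (1 + j * 2) ≡ h + j * (h * 2)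
    expand = solve-∀
    u%t≡h : u % t ≡ h
    u%t≡h = begin
      (h * (n / t)) % t                     ≡⟨ cong (λ m → (h * m) % t) (odd⇒≡1+2q 2∤n/t) ⟩
      (h * (1 + n / t / 2 * 2)) % t         ≡⟨ cong (_% t) (trans (expand h (n / t / 2)) (cong (λ v → h + n / t / 2 * v) (sym t≡h*2))) ⟩
      (h + n / t / 2 * t) % t               ≡⟨ [m+kn]%n≡m%n h (n / t / 2) t ⟩
      h % t                                 ≡⟨ m<n⇒m%n≡m (half< h+h≡t) ⟩
      h                                     ∎
      where open ≡-Reasoning
    toℕc%t≡h : toℕ c % t ≡ h
    toℕc%t≡h = trans (cong (_% t) (toℕ-fromℕ< (half< {u} u+u≡n))) u%t≡h
    middle : ∀ k → toℕ k % t + toℕ k % t ≡ t → k ∼ c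
    middle k r+r≡t = trans (double-injective (trans r+r≡t (sym h+h≡t))) (sym toℕc%t≡h)
    short-𝟘 : Short 𝟘
    short-𝟘 = inj₁ (subst (λ v → v + v < t) (sym toℕ-𝟘) (>-nonZero⁻¹ t))
    𝟘≁c : ¬ 𝟘 ∼ c
    𝟘≁c 𝟘∼c = ≢-nonZero⁻¹ t (trans (sym h+h≡t) (cong (λ v → v + v) (sym 0≡h)))
      where
      0≡h : 0 ≡ h
      0≡h = trans (sym 0%d≡0) (trans (cong (_% t) (sym toℕ-𝟘)) (trans 𝟘∼c toℕc%t≡h))

  odd-evenQuotient-totalPerfectCode : ¬ 2 ∣ t → 2 ∣ n / t → IsTotalPerfectCode ⟨ pow a t ⟩
  odd-evenQuotient-totalPerfectCode 2∤t (divides j n/t≡j*2) = totalPerfectCode-of-transversal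
    (withCentre-isTransversal c (⊖-half u+u≡n) no-middle) (withCentre-⊖ c (⊖-half u+u≡n) no-middle) 𝟘∉R
    where
    u = t * j
    u+u≡n : u + u ≡ n
    u+u≡n = trans (sym (*-distribˡ-+ t j j)) (trans (cong (t *_) (trans (double≡*2 j) (sym n/t≡j*2))) t*[n/t]≡n)
    c : Fin n
    c = fromℕ< (half< {u} u+u≡n)
    no-middle : ∀ k → toℕ k % t + toℕ k % t ≡ t → k ∼ c
    no-middle k r+r≡t = contradiction r+r≡t (odd≢double 2∤t (toℕ k % t))
    𝟘∼c : 𝟘 ∼ c
    𝟘∼c = trans (cong (_% t) toℕ-𝟘) (sym (trans (cong (_% t) (toℕ-fromℕ< (half< {u} u+u≡n))) (∣⇒≋0 (m∣m*n j))))
    𝟘∉R : ¬ WithCentre c (⊖-half u+u≡n) no-middle 𝟘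
    𝟘∉R (inj₁ (_ , 𝟘≁c)) = 𝟘≁c 𝟘∼c
    𝟘∉R (inj₂ 𝟘≡c)       = ≢-nonZero⁻¹ n (trans (sym u+u≡n) (cong (λ v → v + v) (sym 0≡u)))
      where
      0≡u : 0 ≡ u
      0≡u = trans (sym toℕ-𝟘) (trans (cong toℕ 𝟘≡c) (toℕ-fromℕ< (half< {u} u+u≡n)))

lemma2p9 : (n t : ℕ) → {{_ : NonZero n}} → {{_ : NonZero t}} → 3 ≤ n → t ∣ n →
    let open Dihedral n in
      (IsPerfectCode ⟨ pow a t ⟩ ⇔ (¬ (2 ∣ t) ⊎ ¬ (2 ∣ (n / t))))
      × (IsTotalPerfectCode ⟨ pow a t ⟩ ⇔ (¬ (2 ∣ t) × 2 ∣ (n / t)))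
lemma2p9 n t _ t∣n = mk⇔ perfect⇒ perfect⇐ , mk⇔ total⇒ total⇐
  where
  open Dihedral n
  open DihedralCodes n t t∣n

  perfect⇒ : IsPerfectCode ⟨ pow a t ⟩ → ¬ 2 ∣ t ⊎ ¬ 2 ∣ n / t
  perfect⇒ code with 2 ∣? t | 2 ∣? n / t
  ... | no 2∤t  | _          = inj₁ 2∤t
  ... | yes _   | no 2∤n/t   = inj₂ 2∤n/t
  ... | yes 2∣t | yes 2∣n/t  = contradiction code (even-evenQuotient-¬perfectCode 2∣t 2∣n/t)

  perfect⇐ : ¬ 2 ∣ t ⊎ ¬ 2 ∣ n / t → IsPerfectCode ⟨ pow a t ⟩
  perfect⇐ (inj₁ 2∤t) = odd-perfectCode 2∤t
  perfect⇐ (inj₂ 2∤n/t) with 2 ∣? t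
  ... | yes 2∣t = even-oddQuotient-perfectCode 2∣t 2∤n/t
  ... | no  2∤t = odd-perfectCode 2∤t

  total⇒ : IsTotalPerfectCode ⟨ pow a t ⟩ → ¬ 2 ∣ t × 2 ∣ n / t
  total⇒ code with 2 ∣? t | 2 ∣? n / t
  ... | _       | no 2∤n/t  = contradiction code (oddQuotient-¬totalPerfectCode 2∤n/t)
  ... | yes 2∣t | yes 2∣n/t = contradiction code (even-evenQuotient-¬totalPerfectCode 2∣t 2∣n/t)
  ... | no  2∤t | yes 2∣n/t = 2∤t , 2∣n/t

  total⇐ : ¬ 2 ∣ t × 2 ∣ n / t → IsTotalPerfectCode ⟨ pow a t ⟩
  total⇐ (2∤t , 2∣n/t) = odd-evenQuotient-totalPerfectCode 2∤t 2∣n/t
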